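{- Let $n=2k$ with $k\geq 2$ and let $S_n$ be the $n$-sunlet graph. Then $\psi_E(S_n)>2$.
   Context: All graphs are simple, connected and undirected. The $n$-sunlet graph $S_n$ is obtained from the cycle $C_n$ by attaching one pendant edge at each vertex of the cycle. For a graph $G$, the edge distance $d_E(f,g)$ between edges $f,g\in E(G)$ is the distance between $f$ and $g$ as vertices of the line graph $L(G)$. Two edges $f,g$ are said to edge doubly resolve edges $f_1,f_2$ if $d_E(f_1,f)-d_E(f_1,g)\neq d_E(f_2,f)-d_E(f_2,g)$. A set $D_E\subseteq E(G)$ is an edge version of doubly resolving set of $G$ if every pair of distinct edges $e\neq f$ of $G$ is edge doubly resolved by some two edges of $D_E$. $\psi_E(G)$ denotes the minimum cardinality of an edge version of doubly resolving set of $G$. -}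

module Defs where

open import Data.Nat using (ℕ; zero; suc; _+_; _*_; _<_; _≤_; _%_)
open import Data.Fin using (Fin; toℕ)
open import Data.Integer using (ℤ; +_; _-_)
open import Data.List using (List)
open import Data.List.Membership.Propositional using (_∈_)
open import Data.Product using (Σ; _×_; ∃; ∃-syntax)
open import Data.Sum using (_⊎_)
open import Relation.Nullary using (¬_)
open import Relation.Binary.PropositionalEquality using (_≡_; _≢_)

-- A (simple, undirected) graph on the vertex set Fin m, given by an
-- adjacency relation (assumed symmetric and irreflexive by construction).
record Graph : Set₁ where
  field
    m   : ℕ
    Adj : Fin m → Fin m → Set
open Graph public

-- An edge {u,v} is represented canonically by its endpoints with u < v.
record Edge (G : Graph) : Set where
  constructor edge
  field
    lo  : Fin (m G)
    hi  : Fin (m G)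
    lo<hi : toℕ lo < toℕ hi
    adj : Adj G lo hi
open Edge public

SameEdge : {G : Graph} → Edge G → Edge G → Set
SameEdge e f = lo e ≡ lo f × hi e ≡ hi f

LineAdj : {G : Graph} → Edge G → Edge G → Set
LineAdj e f = ¬ SameEdge e f ×
  (lo e ≡ lo f ⊎ lo e ≡ hi f ⊎ hi e ≡ lo f ⊎ hi e ≡ hi f)

data LWalk {G : Graph} : Edge G → Edge G → ℕ → Set where
  here : {e f : Edge G} → SameEdge e f → LWalk e f 0
  step : {e g f : Edge G} {d : ℕ} → LineAdj e g → LWalk g f d → LWalk e f (suc d)

EdgeDist : {G : Graph} → Edge G → Edge G → ℕ → Set
EdgeDist e f d = LWalk e f d × (∀ d' → LWalk e f d' → d ≤ d')

EdgeDoublyResolving : {G : Graph} → List (Edge G) → Set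
EdgeDoublyResolving {G} D =
  (e₁ e₂ : Edge G) → ¬ SameEdge e₁ e₂ →
  ∃[ f ] ∃[ g ] (f ∈ D × g ∈ D ×
    ∃[ a ] ∃[ b ] ∃[ c ] ∃[ d ]
      (EdgeDist e₁ f a × EdgeDist e₁ g b × EdgeDist e₂ f c × EdgeDist e₂ g d ×
       ((+ a) - (+ b)) ≢ ((+ c) - (+ d))))

-- The n-sunlet graph S_n on vertices Fin (n + n): vertex i < n is the i-th
-- cycle vertex, vertex n + i is the pendant vertex attached to cycle vertex i.
-- v is the successor of u on the cycle 0,1,...,n-1,0.
CycSucc : ℕ → ℕ → ℕ → Set
CycSucc n u v = v ≡ suc u ⊎ (suc u ≡ n × v ≡ 0)

SunletAdjℕ : ℕ → ℕ → ℕ → Set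
SunletAdjℕ n u v =
    (u < n × v < n × (CycSucc n u v ⊎ CycSucc n v u))
  ⊎ (u < n × v ≡ n + u)
  ⊎ (v < n × u ≡ n + v)

Sunlet : ℕ → Graph
Sunlet n = record { m = n + n ; Adj = λ u v → SunletAdjℕ n (toℕ u) (toℕ v) }

module Submission where

-- ψ_E(S_n) > 2: no set of at most two edges edge-doubly-resolves the sunlet S_n.
--
-- Suppose the pair {f,g} edge-doubly-resolves a graph G.  Then the
-- offset  e ↦ d_E(e,f) - d_E(e,g)  separates any two distinct edges, and by
-- the triangle inequality it only takes values in [-d_E(f,g), d_E(g,f)].  If f
-- and g lie on a closed walk of length L in the line graph, that interval has
-- at most L + 1 integers, so G has at most L + 1 edges (pair-not-resolving).
-- In S_n any two edges lie on a closed walk of length at most n + 2: go once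
-- around the rim (the n-cycle of L(S_n)), detouring through at most two pendant
-- edges (SunletRim.round-trip).  As S_n has 2n > n + 3 edges, no pair resolves
-- it, and neither does a smaller set, since it is contained in a pair.

open import Defs
open import Data.Nat using (ℕ; zero; suc; _+_; _*_; _∸_; _≤_; _<_; z≤n; s≤s; z<s; _≤?_; _<?_)
open import Data.Nat.Properties
open import Data.Nat.Tactic.RingSolver using (solve-∀)
open import Data.Fin as Fin using (Fin; toℕ; fromℕ<; splitAt; join)
open import Data.Fin.Properties
  using (toℕ-fromℕ<; toℕ-injective; toℕ<n; pigeonhole; join-splitAt) renaming (_≟_ to _≟ᶠ_)
import Data.Integer as ℤ
open import Data.Integer using (_⊖_)
open import Data.Integer.Properties using ([+m]-[+n]≡m⊖n; +-cancelˡ-⊖)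
open import Data.List using (List; length; []; _∷_)
open import Data.List.Membership.Propositional using (_∈_)
open import Data.List.Relation.Unary.Any using (here; there)
open import Data.Product using (∃-syntax; _×_; _,_; proj₁; proj₂)
open import Data.Sum as Sum using (_⊎_; inj₁; inj₂)
open import Function using (_∘_)
open import Relation.Nullary using (¬_; Dec; yes; no; contradiction)
open import Relation.Nullary.Decidable using (_×-dec_; recompute)
open import Relation.Binary.PropositionalEquality

Touching : {A : Set} → A → A → A → A → Set
Touching l h l' h' = ¬ (l ≡ l' × h ≡ h') × (l ≡ l' ⊎ l ≡ h' ⊎ h ≡ l' ⊎ h ≡ h')

touching-reflect : {A B : Set} (φ : A → B) → (∀ {x y} → φ x ≡ φ y → x ≡ y) →
  ∀ {l h l' h'} → Touching (φ l) (φ h) (φ l') (φ h') → Touching l h l' h'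
touching-reflect φ φ-inj (different , shared) =
  (λ (p , q) → different (cong φ p , cong φ q)) ,
  Sum.map φ-inj (Sum.map φ-inj (Sum.map φ-inj φ-inj)) shared

difference-≡ : ∀ a b c d → a + d ≡ c + b → ℤ.+ a ℤ.- ℤ.+ b ≡ ℤ.+ c ℤ.- ℤ.+ d
difference-≡ a b c d eq = begin
  ℤ.+ a ℤ.- ℤ.+ b    ≡⟨ [+m]-[+n]≡m⊖n a b ⟩
  a ⊖ b              ≡⟨ +-cancelˡ-⊖ d a b ⟨
  (d + a) ⊖ (d + b)  ≡⟨ cong₂ _⊖_ (trans (+-comm d a) (trans eq (+-comm c b))) (+-comm d b) ⟩
  (b + c) ⊖ (b + d)  ≡⟨ +-cancelˡ-⊖ b c d ⟩
  c ⊖ d              ≡⟨ [+m]-[+n]≡m⊖n c d ⟨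
  ℤ.+ c ℤ.- ℤ.+ d    ∎
  where open ≡-Reasoning

module _ {G : Graph} where

  same-refl : {e : Edge G} → SameEdge e e
  same-refl = refl , refl

  same-sym : {e f : Edge G} → SameEdge e f → SameEdge f e
  same-sym (p , q) = sym p , sym q

  same-resp : {e e' f f' : Edge G} → SameEdge e e' → SameEdge f f' → SameEdge e f → SameEdge e' f'
  same-resp (refl , refl) (refl , refl) s = s

  same? : (e f : Edge G) → Dec (SameEdge e f)
  same? e f = (lo e ≟ᶠ lo f) ×-dec (hi e ≟ᶠ hi f)

  adj-resp : {e e' g g' : Edge G} → SameEdge e e' → SameEdge g g' → LineAdj e g → LineAdj e' g'
  adj-resp (refl , refl) (refl , refl) a = a

  walk-resp : {e e' f f' : Edge G} {d : ℕ} → SameEdge e e' → SameEdge f f' →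
              LWalk e f d → LWalk e' f' d
  walk-resp (p , q) (r , s) (here (u , v)) =
    here (trans (sym p) (trans u r) , trans (sym q) (trans v s))
  walk-resp {e} {e'} {f} {f'} s t (step {g = g} a w) =
    step (adj-resp {e} {e'} {g} {g} s (same-refl {g}) a) (walk-resp {g} {g} {f} {f'} (same-refl {g}) t w)

  _++w_ : {e g f : Edge G} {d₁ d₂ : ℕ} → LWalk e g d₁ → LWalk g f d₂ → LWalk e f (d₁ + d₂)
  _++w_ {e} {g} {f} (here s) w = walk-resp {g} {e} {f} {f} (same-sym {e} {g} s) (same-refl {f}) w
  step a w ++w w' = step a (w ++w w')

  dist-unique : {e f : Edge G} {a b : ℕ} → EdgeDist e f a → EdgeDist e f b → a ≡ b
  dist-unique (wa , min-a) (wb , min-b) = ≤-antisym (min-a _ wb) (min-b _ wa)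

  -- An edge used as both resolvers never separates e₁ from e₂.
  twice-the-same : {e₁ e₂ h : Edge G} {a b c d : ℕ} → EdgeDist e₁ h a → EdgeDist e₁ h b →
                   EdgeDist e₂ h c → EdgeDist e₂ h d → a + d ≡ c + b
  twice-the-same {a = a} {c = c} da db dc dd =
    trans (cong (a +_) (sym (dist-unique dc dd))) (trans (+-comm a c) (cong (c +_) (dist-unique da db)))

  -- Ends e u v : the endpoints of e, read in ℕ, are u (lower) and v (upper).
  -- Sunlet edges are built from natural numbers, so we reason through Ends.
  record Ends (e : Edge G) (u v : ℕ) : Set where
    constructor ends
    field
      lo-is : toℕ (lo e) ≡ u
      hi-is : toℕ (hi e) ≡ v

  ends-same : {e f : Edge G} {u v : ℕ} → Ends e u v → Ends f u v → SameEdge e f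
  ends-same (ends p q) (ends r s) = toℕ-injective (trans p (sym r)) , toℕ-injective (trans q (sym s))

  same-ends : {e f : Edge G} {u v u' v' : ℕ} → Ends e u v → Ends f u' v' → SameEdge e f →
              u ≡ u' × v ≡ v'
  same-ends (ends refl refl) (ends refl refl) (p , q) = cong toℕ p , cong toℕ q

  ends-adj : {e f : Edge G} {u v u' v' : ℕ} → Ends e u v → Ends f u' v' →
             Touching u v u' v' → LineAdj e f
  ends-adj (ends refl refl) (ends refl refl) t = touching-reflect toℕ toℕ-injective t

  RoundTrip : Edge G → Edge G → ℕ → Set
  RoundTrip f g L = ∃[ l₁ ] ∃[ l₂ ] (LWalk f g l₁ × LWalk g f l₂ × l₁ + l₂ ≤ L)

  resolving-mono : {D D' : List (Edge G)} → (∀ {x} → x ∈ D → x ∈ D') →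
                   EdgeDoublyResolving D → EdgeDoublyResolving D'
  resolving-mono D⊆D' resolving e₁ e₂ e₁≠e₂ with resolving e₁ e₂ e₁≠e₂
  ... | f , g , f∈D , g∈D , rest = f , g , D⊆D' f∈D , D⊆D' g∈D , rest

  within-pair : (D : List (Edge G)) → length D ≤ 2 → Edge G →
                ∃[ f ] ∃[ g ] (∀ {x} → x ∈ D → x ∈ f ∷ g ∷ [])
  within-pair [] _ e = e , e , λ ()
  within-pair (f ∷ []) _ _ = f , f , λ { (here p) → here p ; (there ()) }
  within-pair (f ∷ g ∷ []) _ _ = f , g , λ x∈ → x∈
  within-pair (_ ∷ _ ∷ _ ∷ _) (s≤s (s≤s ())) _

-- Throughout, {f,g} is a doubly resolving pair of G, and every edge has some
-- different edge (so that it occurs in a pair that must be resolved).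
module ResolvingPair {G : Graph} (f g : Edge G)
    (resolving : EdgeDoublyResolving (f ∷ g ∷ []))
    (partner : (e : Edge G) → ∃[ e' ] ¬ SameEdge e e') where

  Separated : Edge G → Edge G → Set
  Separated e₁ e₂ = ∃[ a ] ∃[ b ] ∃[ c ] ∃[ d ]
    (EdgeDist e₁ f a × EdgeDist e₁ g b × EdgeDist e₂ f c × EdgeDist e₂ g d × a + d ≢ c + b)

  -- A single edge never resolves anything, so the two resolvers are f and g.
  separated : {e₁ e₂ : Edge G} → ¬ SameEdge e₁ e₂ → Separated e₁ e₂
  separated {e₁} {e₂} e₁≠e₂ with resolving e₁ e₂ e₁≠e₂
  ... | _ , _ , here refl , here refl , a , b , c , d , da , db , dc , dd , differ =
    contradiction (difference-≡ a b c d (twice-the-same da db dc dd)) differ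
  ... | _ , _ , here refl , there (here refl) , a , b , c , d , da , db , dc , dd , differ =
    a , b , c , d , da , db , dc , dd , differ ∘ difference-≡ a b c d
  ... | _ , _ , there (here refl) , here refl , a , b , c , d , da , db , dc , dd , differ =
    b , a , d , c , db , da , dd , dc ,
    λ eq → differ (difference-≡ a b c d (trans (+-comm a d) (trans (sym eq) (+-comm b c))))
  ... | _ , _ , there (here refl) , there (here refl) , a , b , c , d , da , db , dc , dd , differ =
    contradiction (difference-≡ a b c d (twice-the-same da db dc dd)) differ
  ... | _ , _ , there (there ()) , _
  ... | _ , _ , _ , there (there ()) , _

  -- Every edge has distances to f and to g, read off from a pair it lies in.
  distances : (e : Edge G) → ∃[ a ] ∃[ b ] (EdgeDist e f a × EdgeDist e g b)
  distances e with separated {e} {proj₁ (partner e)} (proj₂ (partner e))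
  ... | a , b , _ , _ , da , db , _ = a , b , da , db

  dF dG : Edge G → ℕ
  dF e = proj₁ (distances e)
  dG e = proj₁ (proj₂ (distances e))

  distF : (e : Edge G) → EdgeDist e f (dF e)
  distF e = proj₁ (proj₂ (proj₂ (distances e)))

  distG : (e : Edge G) → EdgeDist e g (dG e)
  distG e = proj₂ (proj₂ (proj₂ (distances e)))

  separation : {e₁ e₂ : Edge G} → ¬ SameEdge e₁ e₂ → dF e₁ + dG e₂ ≢ dF e₂ + dG e₁
  separation {e₁} {e₂} e₁≠e₂ with separated e₁≠e₂
  ... | a , b , c , d , da , db , dc , dd , differ
    rewrite dist-unique da (distF e₁) | dist-unique db (distG e₁)
          | dist-unique dc (distF e₂) | dist-unique dd (distG e₂) = differ

  dF-via-g : (e : Edge G) → dF e ≤ dG e + dF g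
  dF-via-g e = proj₂ (distF e) _ (proj₁ (distG e) ++w proj₁ (distF g))

  dG-via-f : (e : Edge G) → dG e ≤ dF e + dG f
  dG-via-f e = proj₂ (distG e) _ (proj₁ (distF e) ++w proj₁ (distG f))

  -- The signed difference d(e,f) - d(e,g), shifted by d(f,g) into ℕ.
  offset : Edge G → ℕ
  offset e = dF e + dG f ∸ dG e

  offset-spec : (e : Edge G) → offset e + dG e ≡ dF e + dG f
  offset-spec e = m∸n+n≡m (dG-via-f e)

  offset-bound : (e : Edge G) → offset e ≤ dF g + dG f
  offset-bound e = begin
    dF e + dG f ∸ dG e                ≤⟨ ∸-monoˡ-≤ (dG e) (+-monoˡ-≤ (dG f) (dF-via-g e)) ⟩
    dG e + dF g + dG f ∸ dG e         ≡⟨ cong (_∸ dG e) (+-assoc (dG e) (dF g) (dG f)) ⟩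
    dG e + (dF g + dG f) ∸ dG e       ≡⟨ m+n∸m≡n (dG e) (dF g + dG f) ⟩
    dF g + dG f                       ∎
    where open ≤-Reasoning

  offset-separates : {e₁ e₂ : Edge G} → ¬ SameEdge e₁ e₂ → offset e₁ ≢ offset e₂
  offset-separates {e₁} {e₂} e₁≠e₂ same-offset = separation e₁≠e₂ (+-cancelʳ-≡ (dG f) _ _ (begin
    dF e₁ + dG e₂ + dG f          ≡⟨ swap-last (dF e₁) (dG e₂) (dG f) ⟩
    dF e₁ + dG f + dG e₂          ≡⟨ cong (_+ dG e₂) (offset-spec e₁) ⟨
    offset e₁ + dG e₁ + dG e₂     ≡⟨ cong (λ o → o + dG e₁ + dG e₂) same-offset ⟩
    offset e₂ + dG e₁ + dG e₂     ≡⟨ swap-last (offset e₂) (dG e₁) (dG e₂) ⟩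
    offset e₂ + dG e₂ + dG e₁     ≡⟨ cong (_+ dG e₁) (offset-spec e₂) ⟩
    dF e₂ + dG f + dG e₁          ≡⟨ swap-last (dF e₂) (dG f) (dG e₁) ⟩
    dF e₂ + dG e₁ + dG f          ∎))
    where
    open ≡-Reasoning
    swap-last : ∀ x y z → x + y + z ≡ x + z + y
    swap-last x y z = trans (+-assoc x y z) (trans (cong (x +_) (+-comm y z)) (sym (+-assoc x z y)))

-- Counting: if G has N pairwise distinct edges and f, g lie on a closed walk
-- of length L with L + 1 < N, then {f,g} is not doubly resolving, because the
-- N offsets would be distinct numbers in [0, L].
pair-not-resolving : {G : Graph} {N L : ℕ} (en : Fin N → Edge G) →
  (∀ i j → SameEdge (en i) (en j) → i ≡ j) →
  (f g : Edge G) → RoundTrip f g L → suc L < N → ¬ EdgeDoublyResolving (f ∷ g ∷ [])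
pair-not-resolving {N = suc zero} _ _ _ _ _ (s≤s ())
pair-not-resolving {G} {suc (suc N)} {L} en en-injective f g (l₁ , l₂ , f→g , g→f , l₁+l₂≤L) L<N resolving
  = let i , j , i<j , same-slot = pigeonhole L<N slot in
    offset-separates (λ s → <-irrefl (cong toℕ (en-injective i j s)) i<j)
      (trans (sym (toℕ-fromℕ< (slot-bound i))) (trans (cong toℕ same-slot) (toℕ-fromℕ< (slot-bound j))))
  where
  different : ¬ SameEdge (en Fin.zero) (en (Fin.suc Fin.zero))
  different s with () ← en-injective Fin.zero (Fin.suc Fin.zero) s

  partner : (e : Edge G) → ∃[ e' ] ¬ SameEdge e e'
  partner e with same? e (en Fin.zero)
  ... | no e≠en₀ = en Fin.zero , e≠en₀
  ... | yes (p , q) = en (Fin.suc Fin.zero) , λ (r , s) → different (trans (sym p) r , trans (sym q) s)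

  open ResolvingPair f g resolving partner

  slot-bound : (i : Fin (suc (suc N))) → offset (en i) < suc L
  slot-bound i = s≤s (≤-trans (offset-bound (en i))
    (≤-trans (+-mono-≤ (proj₂ (distF g) l₂ g→f) (proj₂ (distG f) l₁ f→g))
             (subst (_≤ L) (+-comm l₁ l₂) l₁+l₂≤L)))

  slot : Fin (suc (suc N)) → Fin (suc L)
  slot i = fromℕ< (slot-bound i)

-- The sunlet S_n for n = n1 + 1 ≥ 3.  Its rim is the cycle of edges
-- rim 0, rim 1, …, rim n1, where rim j = {j, j+1} for j < n1 and
-- rim n1 = {0, n1} closes the cycle; pendant v = {v, n+v} hangs at vertex v.
module SunletRim (n1 : ℕ) (1<n1 : 1 < n1) where

  n : ℕ
  n = suc n1

  E : Set
  E = Edge (Sunlet n)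

  -- The edge {u, v} of S_n given by its endpoints u < v in ℕ.  The bound
  -- v < 2n is irrelevant, so edges built from equal numbers agree.
  edgeℕ : (u v : ℕ) → .(v < n + n) → u < v → SunletAdjℕ n u v → E
  edgeℕ u v v<2n u<v adj = edge (fromℕ< (<-trans u<v v<2n)) (fromℕ< v<2n)
    (subst₂ _<_ (sym (toℕ-fromℕ< (<-trans u<v v<2n))) (sym (toℕ-fromℕ< v<2n)) u<v)
    (subst₂ (SunletAdjℕ n) (sym (toℕ-fromℕ< (<-trans u<v v<2n))) (sym (toℕ-fromℕ< v<2n)) adj)

  <n⇒<n+n : {v : ℕ} → v < n → v < n + n
  <n⇒<n+n v<n = ≤-trans v<n (m≤m+n n n)

  -- rim j for j ≤ n1 (positions beyond n1 also give the closing edge).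
  rim : ℕ → E
  rim j with j <? n1
  ... | yes j<n1 = edgeℕ j (suc j) (<n⇒<n+n (s≤s j<n1))
                     (n<1+n j) (inj₁ (<-trans j<n1 (n<1+n n1) , s≤s j<n1 , inj₁ (inj₁ refl)))
  ... | no _ = edgeℕ 0 n1 (<n⇒<n+n (n<1+n n1))
                 (<-trans z<s 1<n1) (inj₁ (z<s , n<1+n n1 , inj₂ (inj₂ (refl , refl))))

  rim-arc : {j : ℕ} → j < n1 → Ends (rim j) j (suc j)
  rim-arc {j} j<n1 with j <? n1
  ... | yes _ = ends (toℕ-fromℕ< (<n⇒<n+n (<-trans j<n1 (n<1+n n1))))
                     (toℕ-fromℕ< (<n⇒<n+n (s≤s j<n1)))
  ... | no j≮n1 = contradiction j<n1 j≮n1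

  rim-close : {j : ℕ} → j ≡ n1 → Ends (rim j) 0 n1
  rim-close {j} refl with n1 <? n1
  ... | yes n1<n1 = contradiction n1<n1 (<-irrefl refl)
  ... | no _ = ends (toℕ-fromℕ< (<n⇒<n+n z<s)) (toℕ-fromℕ< (<n⇒<n+n (n<1+n n1)))

  -- pendant v for v < n; the bound is irrelevant (recomputed for the adjacency).
  pendant : (v : ℕ) → .(v < n) → E
  pendant v v<n = edgeℕ v (n + v) (+-monoʳ-< n v<n) (m<n+m v z<s)
    (inj₂ (inj₁ (recompute (v <? n) v<n , refl)))

  pendant-ends : {v : ℕ} .(v<n : v < n) → Ends (pendant v v<n) v (n + v)
  pendant-ends v<n = ends (toℕ-fromℕ< (<n⇒<n+n v<n)) (toℕ-fromℕ< (+-monoʳ-< n v<n))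

  pendant-high : {v w : ℕ} → w < n → n + v ≢ w
  pendant-high {v} w<n refl = <-irrefl refl (<-≤-trans w<n (m≤m+n n v))

  -- For n ≥ 3 the closing edge differs from rim 0 and rim (n1 - 1).
  n1≢1 : n1 ≢ 1
  n1≢1 n1≡1 = <-irrefl (sym n1≡1) 1<n1

  rim-next : {j : ℕ} → j < n1 → LineAdj (rim j) (rim (suc j))
  rim-next {j} j<n1 with m≤n⇒m<n∨m≡n j<n1
  ... | inj₁ j+1<n1 = ends-adj (rim-arc j<n1) (rim-arc j+1<n1)
    ((λ (j≡j+1 , _) → 1+n≢n (sym j≡j+1)) , inj₂ (inj₂ (inj₁ refl)))
  ... | inj₂ j+1≡n1 = ends-adj (rim-arc j<n1) (rim-close j+1≡n1)
    ((λ (j≡0 , _) → n1≢1 (trans (sym j+1≡n1) (cong suc j≡0))) , inj₂ (inj₂ (inj₂ j+1≡n1)))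

  rim-wrap : LineAdj (rim n1) (rim 0)
  rim-wrap = ends-adj (rim-close refl) (rim-arc (<-trans z<s 1<n1))
    ((λ (_ , n1≡1) → n1≢1 n1≡1) , inj₁ refl)

  -- The pendant edge at v leaves towards rim v and is entered from the rim edge
  -- before it, rim (prev v).
  prev : ℕ → ℕ
  prev zero = n1
  prev (suc w) = w

  pendant-leave : {v : ℕ} (v≤n1 : v ≤ n1) → LineAdj (pendant v (s≤s v≤n1)) (rim v)
  pendant-leave {v} v≤n1 with m≤n⇒m<n∨m≡n v≤n1
  ... | inj₁ v<n1 = ends-adj (pendant-ends (s≤s v≤n1)) (rim-arc v<n1)
    ((λ (_ , high) → pendant-high (s≤s v<n1) high) , inj₁ refl)
  ... | inj₂ v≡n1 = ends-adj (pendant-ends (s≤s v≤n1)) (rim-close v≡n1)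
    ((λ (_ , high) → pendant-high (n<1+n n1) high) , inj₂ (inj₁ v≡n1))

  pendant-arrive : {v : ℕ} (v≤n1 : v ≤ n1) → LineAdj (rim (prev v)) (pendant v (s≤s v≤n1))
  pendant-arrive {zero} 0≤n1 = ends-adj (rim-close refl) (pendant-ends (s≤s 0≤n1))
    ((λ (_ , n1≡high) → pendant-high (n<1+n n1) (sym n1≡high)) , inj₁ refl)
  pendant-arrive {suc w} w<n1 = ends-adj (rim-arc w<n1) (pendant-ends (s≤s w<n1))
    ((λ (w≡w+1 , _) → 1+n≢n (sym w≡w+1)) , inj₂ (inj₂ (inj₁ refl)))

  climb : (i d : ℕ) → i + d ≤ n1 → LWalk (rim i) (rim (i + d)) d
  climb i zero _ = subst (λ t → LWalk (rim i) (rim t) 0) (sym (+-identityʳ i)) (here (refl , refl))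
  climb i (suc d) i+d+1≤n1 =
    step (rim-next (≤-trans (s≤s (m≤m+n i d)) i+1+d≤n1))
         (subst (λ t → LWalk (rim (suc i)) (rim t) d) (sym (+-suc i d)) (climb (suc i) d i+1+d≤n1))
    where
    i+1+d≤n1 : suc i + d ≤ n1
    i+1+d≤n1 = subst (_≤ n1) (+-suc i d) i+d+1≤n1

  climb-to : {i j : ℕ} → i ≤ j → j ≤ n1 → LWalk (rim i) (rim j) (j ∸ i)
  climb-to {i} {j} i≤j j≤n1 = subst (λ t → LWalk (rim i) (rim t) (j ∸ i)) (m+[n∸m]≡n i≤j)
    (climb i (j ∸ i) (subst (_≤ n1) (sym (m+[n∸m]≡n i≤j)) j≤n1))

  -- Number of steps from rim i forward (in increasing positions) to rim j.
  rimDist : ℕ → ℕ → ℕ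
  rimDist i j with i ≤? j
  ... | yes _ = j ∸ i
  ... | no _ = n1 ∸ i + suc j

  around : {i j : ℕ} → i ≤ n1 → j ≤ n1 → LWalk (rim i) (rim j) (rimDist i j)
  around {i} {j} i≤n1 j≤n1 with i ≤? j
  ... | yes i≤j = climb-to i≤j j≤n1
  ... | no _ = climb-to i≤n1 ≤-refl ++w step rim-wrap (climb-to z≤n j≤n1)

  rimDist-up : {i j : ℕ} → i ≤ j → i + rimDist i j ≡ j
  rimDist-up {i} {j} i≤j with i ≤? j
  ... | yes _ = m+[n∸m]≡n i≤j
  ... | no i≰j = contradiction i≤j i≰j

  rimDist-wrap : {i j : ℕ} → j < i → i ≤ n1 → i + rimDist i j ≡ n + j
  rimDist-wrap {i} {j} j<i i≤n1 with i ≤? j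
  ... | yes i≤j = contradiction i≤j (<⇒≱ j<i)
  ... | no _ = begin
    i + (n1 ∸ i + suc j)  ≡⟨ +-assoc i (n1 ∸ i) (suc j) ⟨
    i + (n1 ∸ i) + suc j  ≡⟨ cong (_+ suc j) (m+[n∸m]≡n i≤n1) ⟩
    n1 + suc j            ≡⟨ +-suc n1 j ⟩
    n + j                 ∎
    where open ≡-Reasoning

  -- Going from rim i to just before rim j and from rim j back to rim i
  -- walks once around the rim, missing one step.
  rim-tour : {i j : ℕ} → i ≤ n1 → j ≤ n1 → rimDist i (prev j) + rimDist j i ≡ n1
  rim-tour {i} {zero} i≤n1 _ = +-cancelˡ-≡ i _ _ (begin
    i + (rimDist i n1 + rimDist 0 i)  ≡⟨ +-assoc i _ _ ⟨
    i + rimDist i n1 + rimDist 0 i    ≡⟨ cong₂ _+_ (rimDist-up i≤n1) (rimDist-up z≤n) ⟩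
    n1 + i                            ≡⟨ +-comm n1 i ⟩
    i + n1                            ∎)
    where open ≡-Reasoning
  rim-tour {i} {suc w} i≤n1 w<n1 with ≤-<-connex i w
  ... | inj₁ i≤w = +-cancelˡ-≡ i _ _ (begin
    i + (rimDist i w + rimDist (suc w) i)  ≡⟨ +-assoc i _ _ ⟨
    i + rimDist i w + rimDist (suc w) i    ≡⟨ cong (_+ rimDist (suc w) i) (rimDist-up i≤w) ⟩
    w + rimDist (suc w) i                  ≡⟨ suc-injective (rimDist-wrap (s≤s i≤w) w<n1) ⟩
    n1 + i                                 ≡⟨ +-comm n1 i ⟩
    i + n1                                 ∎)
    where open ≡-Reasoning
  ... | inj₂ w<i = +-cancelˡ-≡ (suc w) _ _ (begin
    suc w + (rimDist i w + rimDist (suc w) i)  ≡⟨ cong (suc w +_) (+-comm (rimDist i w) _) ⟩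
    suc w + (rimDist (suc w) i + rimDist i w)  ≡⟨ +-assoc (suc w) _ _ ⟨
    suc w + rimDist (suc w) i + rimDist i w    ≡⟨ cong (_+ rimDist i w) (rimDist-up w<i) ⟩
    i + rimDist i w                            ≡⟨ rimDist-wrap w<i i≤n1 ⟩
    n + w                                      ≡⟨ cong suc (+-comm n1 w) ⟩
    suc w + n1                                 ∎)
    where open ≡-Reasoning

  rim-skip : {i j : ℕ} → i ≤ n1 → i ≢ j → suc (rimDist i (prev j)) ≡ rimDist i j
  rim-skip {i} {zero} i≤n1 i≢0 = +-cancelˡ-≡ i _ _ (begin
    i + suc (rimDist i n1)  ≡⟨ +-suc i _ ⟩
    suc (i + rimDist i n1)  ≡⟨ cong suc (rimDist-up i≤n1) ⟩
    n                       ≡⟨ +-identityʳ n ⟨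
    n + 0                   ≡⟨ rimDist-wrap (n≢0⇒n>0 i≢0) i≤n1 ⟨
    i + rimDist i 0         ∎)
    where open ≡-Reasoning
  rim-skip {i} {suc w} i≤n1 i≢w+1 with ≤-<-connex i w
  ... | inj₁ i≤w = +-cancelˡ-≡ i _ _ (begin
    i + suc (rimDist i w)  ≡⟨ +-suc i _ ⟩
    suc (i + rimDist i w)  ≡⟨ cong suc (rimDist-up i≤w) ⟩
    suc w                  ≡⟨ rimDist-up (m≤n⇒m≤1+n i≤w) ⟨
    i + rimDist i (suc w)  ∎)
    where open ≡-Reasoning
  ... | inj₂ w<i = +-cancelˡ-≡ i _ _ (begin
    i + suc (rimDist i w)  ≡⟨ +-suc i _ ⟩
    suc (i + rimDist i w)  ≡⟨ cong suc (rimDist-wrap w<i i≤n1) ⟩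
    suc (n + w)            ≡⟨ +-suc n w ⟨
    n + suc w              ≡⟨ rimDist-wrap (≤∧≢⇒< w<i (i≢w+1 ∘ sym)) i≤n1 ⟨
    i + rimDist i (suc w)  ∎)
    where open ≡-Reasoning

  -- An edge of S_n together with how it is docked on the rim: it is entered
  -- from rim (entry p), left towards rim (exit p), each at cost (cost p).
  data Place : Set where
    rimAt     : (j : ℕ) → j ≤ n1 → Place
    pendantAt : (v : ℕ) → v ≤ n1 → Place

  edgeAt : Place → E
  edgeAt (rimAt j _) = rim j
  edgeAt (pendantAt v v≤n1) = pendant v (s≤s v≤n1)

  entry exit cost : Place → ℕ
  entry (rimAt j _) = j
  entry (pendantAt v _) = prev v
  exit (rimAt j _) = j
  exit (pendantAt v _) = v
  cost (rimAt _ _) = 0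
  cost (pendantAt _ _) = 1

  entry≤n1 : (p : Place) → entry p ≤ n1
  entry≤n1 (rimAt _ j≤n1) = j≤n1
  entry≤n1 (pendantAt zero _) = ≤-refl
  entry≤n1 (pendantAt (suc w) w<n1) = <⇒≤ w<n1

  exit≤n1 : (p : Place) → exit p ≤ n1
  exit≤n1 (rimAt _ j≤n1) = j≤n1
  exit≤n1 (pendantAt _ v≤n1) = v≤n1

  arrive : (p : Place) → LWalk (rim (entry p)) (edgeAt p) (cost p)
  arrive (rimAt _ _) = here (refl , refl)
  arrive (pendantAt v v≤n1) = step {g = pendant v (s≤s v≤n1)} (pendant-arrive v≤n1) (here (refl , refl))

  leave : (p : Place) → LWalk (edgeAt p) (rim (exit p)) (cost p)
  leave (rimAt _ _) = here (refl , refl)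
  leave (pendantAt v v≤n1) = step {g = rim v} (pendant-leave v≤n1) (here (refl , refl))

  passage-length : Place → Place → ℕ
  passage-length p q = cost p + (rimDist (exit p) (entry q) + cost q)

  passage : (p q : Place) → LWalk (edgeAt p) (edgeAt q) (passage-length p q)
  passage p q = leave p ++w (around (exit≤n1 p) (entry≤n1 q) ++w arrive q)

  -- There and back again between two different places costs at most n + 2:
  -- once around the rim plus the detours into at most two pendant edges.
  round-trip-length : (p q : Place) → ¬ SameEdge (edgeAt p) (edgeAt q) →
                      passage-length p q + passage-length q p ≤ n + 2
  round-trip-length (rimAt i i≤n1) (rimAt j j≤n1) i≠j = begin
    (rimDist i j + 0) + (rimDist j i + 0)
      ≡⟨ cong (λ t → (t + 0) + (rimDist j i + 0)) (rim-skip i≤n1 (λ { refl → i≠j (refl , refl) })) ⟨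
    (suc (rimDist i (prev j)) + 0) + (rimDist j i + 0)
      ≡⟨ rearrange (rimDist i (prev j)) (rimDist j i) ⟩
    suc (rimDist i (prev j) + rimDist j i) + 0
      ≡⟨ cong (λ t → suc t + 0) (rim-tour i≤n1 j≤n1) ⟩
    n + 0  ≤⟨ +-monoʳ-≤ n z≤n ⟩
    n + 2  ∎
    where
    open ≤-Reasoning
    rearrange : ∀ x y → (suc x + 0) + (y + 0) ≡ suc (x + y) + 0
    rearrange = solve-∀
  round-trip-length (rimAt i i≤n1) (pendantAt v v≤n1) _ = begin
    (rimDist i (prev v) + 1) + (1 + (rimDist v i + 0))  ≡⟨ rearrange (rimDist i (prev v)) (rimDist v i) ⟩
    suc (rimDist i (prev v) + rimDist v i) + 1          ≡⟨ cong (λ t → suc t + 1) (rim-tour i≤n1 v≤n1) ⟩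
    n + 1                                               ≤⟨ +-monoʳ-≤ n (s≤s z≤n) ⟩
    n + 2                                               ∎
    where
    open ≤-Reasoning
    rearrange : ∀ x y → (x + 1) + (1 + (y + 0)) ≡ suc (x + y) + 1
    rearrange = solve-∀
  round-trip-length (pendantAt v v≤n1) (rimAt j j≤n1) _ = begin
    (1 + (rimDist v j + 0)) + (rimDist j (prev v) + 1)  ≡⟨ rearrange (rimDist j (prev v)) (rimDist v j) ⟩
    suc (rimDist j (prev v) + rimDist v j) + 1          ≡⟨ cong (λ t → suc t + 1) (rim-tour j≤n1 v≤n1) ⟩
    n + 1                                               ≤⟨ +-monoʳ-≤ n (s≤s z≤n) ⟩
    n + 2                                               ∎
    where
    open ≤-Reasoning
    rearrange : ∀ x y → (1 + (y + 0)) + (x + 1) ≡ suc (x + y) + 1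
    rearrange = solve-∀
  round-trip-length (pendantAt u u≤n1) (pendantAt v v≤n1) u≠v = begin
    (1 + (rimDist u (prev v) + 1)) + (1 + (rimDist v (prev u) + 1))
      ≡⟨ rearrange (rimDist u (prev v)) (rimDist v (prev u)) ⟩
    suc (rimDist u (prev v) + suc (rimDist v (prev u))) + 2
      ≡⟨ cong (λ t → suc (rimDist u (prev v) + t) + 2) (rim-skip v≤n1 (λ { refl → u≠v (refl , refl) })) ⟩
    suc (rimDist u (prev v) + rimDist v u) + 2
      ≡⟨ cong (λ t → suc t + 2) (rim-tour u≤n1 v≤n1) ⟩
    n + 2  ∎
    where
    open ≤-Reasoning
    rearrange : ∀ x y → (1 + (x + 1)) + (1 + (y + 1)) ≡ suc (x + suc y) + 2
    rearrange = solve-∀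

  classify : (e : E) → ∃[ p ] SameEdge (edgeAt p) e
  classify e@(edge l h _ (inj₂ (inj₁ (l<n , h≡n+l)))) =
    pendantAt (toℕ l) (≤-pred l<n) , ends-same (pendant-ends l<n) (ends {e = e} refl h≡n+l)
  classify (edge l h l<h (inj₂ (inj₂ (h<n , l≡n+h)))) =
    contradiction (sym l≡n+h) (pendant-high (<-trans l<h h<n))
  classify e@(edge l h _ (inj₁ (_ , h<n , inj₁ (inj₁ h≡l+1)))) =
    rimAt (toℕ l) (<⇒≤ l<n1) , ends-same (rim-arc l<n1) (ends {e = e} refl h≡l+1)
    where
    l<n1 : toℕ l < n1
    l<n1 = ≤-pred (subst (_< n) h≡l+1 h<n)
  classify (edge l h l<h (inj₁ (_ , _ , inj₁ (inj₂ (_ , h≡0))))) =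
    contradiction (subst (toℕ l <_) h≡0 l<h) n≮0
  classify (edge l h l<h (inj₁ (_ , _ , inj₂ (inj₁ l≡h+1)))) =
    contradiction (<-trans (n<1+n (toℕ h)) (subst (_< toℕ h) l≡h+1 l<h)) (n≮n (toℕ h))
  classify e@(edge l h _ (inj₁ (_ , _ , inj₂ (inj₂ (h+1≡n , l≡0))))) =
    rimAt n1 ≤-refl , ends-same (rim-close refl) (ends {e = e} l≡0 (suc-injective h+1≡n))

  round-trip : (f g : E) → RoundTrip f g (n + 2)
  round-trip f g with same? f g
  ... | yes f≡g = 0 , 0 , here f≡g , here (same-sym {e = f} {f = g} f≡g) , z≤n
  ... | no f≠g with classify f | classify g
  ... | p , p≡f | q , q≡g =
    passage-length p q , passage-length q p ,
    walk-resp p≡f q≡g (passage p q) , walk-resp q≡g p≡f (passage q p) ,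
    round-trip-length p q (f≠g ∘ same-resp {e = edgeAt p} {f} {edgeAt q} {g} p≡f q≡g)

  -- The hi endpoint of a rim edge is a rim vertex, so rim ≠ pendant.
  rim-low : {j : ℕ} → j ≤ n1 → toℕ (hi (rim j)) < n
  rim-low j≤n1 with m≤n⇒m<n∨m≡n j≤n1
  ... | inj₁ j<n1 = subst (_< n) (sym (Ends.hi-is (rim-arc j<n1))) (s≤s j<n1)
  ... | inj₂ j≡n1 = subst (_< n) (sym (Ends.hi-is (rim-close j≡n1))) (n<1+n n1)

  rim-injective : {i j : ℕ} → i ≤ n1 → j ≤ n1 → SameEdge (rim i) (rim j) → i ≡ j
  rim-injective i≤n1 j≤n1 s with m≤n⇒m<n∨m≡n i≤n1 | m≤n⇒m<n∨m≡n j≤n1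
  ... | inj₁ i<n1 | inj₁ j<n1 = proj₁ (same-ends (rim-arc i<n1) (rim-arc j<n1) s)
  ... | inj₁ i<n1 | inj₂ j≡n1 =
    let i≡0 , i+1≡n1 = same-ends (rim-arc i<n1) (rim-close j≡n1) s
    in contradiction (trans (sym i+1≡n1) (cong suc i≡0)) n1≢1
  ... | inj₂ i≡n1 | inj₁ j<n1 =
    let 0≡j , n1≡j+1 = same-ends (rim-close i≡n1) (rim-arc j<n1) s
    in contradiction (trans n1≡j+1 (cong suc (sym 0≡j))) n1≢1
  ... | inj₂ i≡n1 | inj₂ j≡n1 = trans i≡n1 (sym j≡n1)

  -- The 2n edges of S_n: n pendant edges followed by n rim edges.
  place : Fin n ⊎ Fin n → Place
  place (inj₁ a) = pendantAt (toℕ a) (≤-pred (toℕ<n a))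
  place (inj₂ b) = rimAt (toℕ b) (≤-pred (toℕ<n b))

  place-injective : (x y : Fin n ⊎ Fin n) → SameEdge (edgeAt (place x)) (edgeAt (place y)) → x ≡ y
  place-injective (inj₁ a) (inj₁ b) s =
    cong inj₁ (toℕ-injective (proj₁ (same-ends (pendant-ends (toℕ<n a)) (pendant-ends (toℕ<n b)) s)))
  place-injective (inj₁ a) (inj₂ b) s = contradiction
    (trans (sym (Ends.hi-is (pendant-ends (toℕ<n a)))) (cong toℕ (proj₂ s)))
    (pendant-high (rim-low (≤-pred (toℕ<n b))))
  place-injective (inj₂ a) (inj₁ b) s = contradiction
    (trans (sym (Ends.hi-is (pendant-ends (toℕ<n b)))) (cong toℕ (sym (proj₂ s))))
    (pendant-high (rim-low (≤-pred (toℕ<n a))))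
  place-injective (inj₂ a) (inj₂ b) s =
    cong inj₂ (toℕ-injective (rim-injective (≤-pred (toℕ<n a)) (≤-pred (toℕ<n b)) s))

  enumerate : Fin (n + n) → E
  enumerate i = edgeAt (place (splitAt n i))

  enumerate-injective : (i j : Fin (n + n)) → SameEdge (enumerate i) (enumerate j) → i ≡ j
  enumerate-injective i j s = begin
    i                        ≡⟨ join-splitAt n n i ⟨
    join n n (splitAt n i)   ≡⟨ cong (join n n) (place-injective (splitAt n i) (splitAt n j) s) ⟩
    join n n (splitAt n j)   ≡⟨ join-splitAt n n j ⟩
    j                        ∎
    where open ≡-Reasoning

sunlet-ψE>2 : (n1 : ℕ) → 3 ≤ n1 → (D : List (Edge (Sunlet (suc n1)))) →
              length D ≤ 2 → ¬ EdgeDoublyResolving D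
sunlet-ψE>2 n1 3≤n1 D |D|≤2 resolving =
  let f , g , D⊆fg = within-pair D |D|≤2 (rim 0) in
  pair-not-resolving enumerate enumerate-injective f g (round-trip f g) room
    (resolving-mono D⊆fg resolving)
  where
  open SunletRim n1 (≤-trans (s≤s (s≤s z≤n)) 3≤n1)

  -- the 2n edges outnumber the n + 3 possible offsets
  room : suc (n + 2) < n + n
  room = subst (_< n + n) (+-suc n 2) (+-monoʳ-< n (s≤s 3≤n1))

-- Lemma 2.1: for n = 2k with k ≥ 2, ψ_E(S_n) > 2.  Here 2 * (2 + k) reduces to
-- suc n1 with n1 = 1 + k + (2 + k + 0).
lemma2p1 : (k : ℕ) → 2 ≤ k → (D : List (Edge (Sunlet (2 * k)))) →
           length D ≤ 2 → ¬ EdgeDoublyResolving D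
lemma2p1 (suc (suc k)) _ = sunlet-ψE>2 (suc (k + suc (suc (k + 0))))
  (s≤s (≤-trans (s≤s (s≤s z≤n)) (m≤n+m (suc (suc (k + 0))) k)))
lemma2p1 (suc zero) (s≤s ())
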